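{- Let $G$ be a finite group. Then the core of every induced subgraph of the power graph $\mathcal P_G$ is a complete graph. Consequently, $\mathcal P_G$ is a core if and only if $G$ is a cyclic group of order $p^m$ for some prime $p$ and nonnegative integer $m$.
   Context: The power graph $\mathcal P_G$ has vertex set $G$, two distinct elements being adjacent iff one is a power of the other. A homomorphism of graphs $\Gamma\to\Gamma'$ is a vertex map sending edges to edges. A core of a graph $\Gamma$ is a subgraph $\Lambda$ such that every homomorphism $\Lambda\to\Lambda$ is an automorphism and there is a homomorphism $\Gamma\to\Lambda$ (it is unique up to isomorphism). A graph is called a core if its core is itself. -}

module Defs where

open import Data.Nat using (ℕ; zero; suc)
open import Data.Fin using (Fin)
open import Data.Bool using (Bool; T)
open import Data.Product using (Σ; ∃; _×_; _,_; proj₁)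
open import Data.Sum using (_⊎_)
open import Relation.Nullary using (¬_)
open import Relation.Binary.PropositionalEquality using (_≡_)
open import Algebra.Structures using (IsGroup)

-- Finite groups: a group structure (w.r.t. propositional equality) on
-- the carrier Fin order.  Every finite group is isomorphic to one of these.

record FiniteGroup : Set₁ where
  field
    order   : ℕ
    _∙_     : Fin order → Fin order → Fin order
    ε       : Fin order
    _⁻¹     : Fin order → Fin order
    isGroup : IsGroup _≡_ _∙_ ε _⁻¹

  Carrier : Set
  Carrier = Fin order

  _^_ : Carrier → ℕ → Carrier
  x ^ zero  = ε
  x ^ suc k = x ∙ (x ^ k)

  IsPowerOf : Carrier → Carrier → Set
  IsPowerOf y x = ∃ λ k → y ≡ x ^ k

  IsCyclic : Set
  IsCyclic = ∃ λ g → ∀ x → IsPowerOf x g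

record Graph : Set₁ where
  field
    V : Set
    E : V → V → Set
open Graph public

IsHom : (Γ Δ : Graph) → (V Γ → V Δ) → Set
IsHom Γ Δ f = ∀ {x y} → E Γ x y → E Δ (f x) (f y)

Hom : Graph → Graph → Set
Hom Γ Δ = Σ (V Γ → V Δ) (IsHom Γ Δ)

IsAutomorphism : (Γ : Graph) → Hom Γ Γ → Set
IsAutomorphism Γ (f , _) =
  Σ (Hom Γ Γ) λ g → (∀ x → proj₁ g (f x) ≡ x) × (∀ x → f (proj₁ g x) ≡ x)

IsCore : Graph → Set
IsCore Γ = (f : Hom Γ Γ) → IsAutomorphism Γ f

IsComplete : Graph → Set
IsComplete Γ = ∀ x y → ¬ (x ≡ y) → E Γ x y

record Subgraph (Γ : Graph) : Set₁ where
  field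
    vert      : V Γ → Bool
    edge      : V Γ → V Γ → Bool
    edge-sub  : ∀ {x y} → T (edge x y) → E Γ x y
    edge-vert : ∀ {x y} → T (edge x y) → T (vert x) × T (vert y)
    edge-sym  : ∀ x y → edge x y ≡ edge y x
open Subgraph public

asGraph : {Γ : Graph} → Subgraph Γ → Graph
asGraph {Γ} Λ = record
  { V = Σ (V Γ) (λ x → T (vert Λ x))
  ; E = λ x y → T (edge Λ (proj₁ x) (proj₁ y)) }

IsCoreOf : (Γ : Graph) → Subgraph Γ → Set
IsCoreOf Γ Λ = IsCore (asGraph Λ) × Hom Γ (asGraph Λ)

Induced : (Γ : Graph) → (V Γ → Bool) → Graph
Induced Γ S = record
  { V = Σ (V Γ) (λ x → T (S x))
  ; E = λ x y → E Γ (proj₁ x) (proj₁ y) }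

PowerGraph : FiniteGroup → Graph
PowerGraph G = record
  { V = Carrier
  ; E = λ x y → ¬ (x ≡ y) × (IsPowerOf y x ⊎ IsPowerOf x y) }
  where open FiniteGroup G

-- The induced subgraph of the power graph on S is the comparability graph of the preorder
-- "x is a power of y" on S.  Breaking ties between elements that generate the same cyclic
-- subgroup by their index gives a strict order, and colouring every vertex by the length of
-- the longest chain ending in it uses exactly as many colours as the longest chain has
-- elements (Mirsky).  So the graph admits homomorphisms to and from a complete graph K n, and
-- then so does each of its cores; a core with homomorphisms to and from K n is K n itself.
-- Consequently the power graph is a core iff it is complete, i.e. iff any two elements of G
-- are powers of one another.  Then G is cyclic, generated by a maximal element g; and since
-- g ^ a is a power of g ^ b iff gcd b |G| divides gcd a |G|, completeness says precisely that
-- the divisors of |G| form a chain under divisibility, which characterises prime powers.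

module Submission where

open import Defs
open import Algebra.Bundles using (Group)
open import Algebra.Structures using (IsGroup)
import Algebra.Properties.Group as GroupProperties
open import Data.Bool using (Bool; true; T; _∧_)
open import Data.Bool.Properties using (T?; T-∧; T-irrelevant; ∧-comm)
open import Data.Fin using (Fin; zero; suc; toℕ; fromℕ; fromℕ<; punchOut; _≟_)
open import Data.Fin.Properties
  using (any?; pigeonhole; injective⇒≤; cantor-schröder-bernstein; ¬∀⟶∃¬-smallest; punchOut-injective;
         nonZeroIndex; toℕ-fromℕ<; toℕ-fromℕ; toℕ-inject; toℕ-injective; toℕ<n)
import Data.Fin.Properties as Fin
open import Data.List using (List; []; _∷_; length; allFin)
open import Data.List.Membership.Propositional using (_∈_)
open import Data.List.Membership.Propositional.Properties using (∈-allFin)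
open import Data.List.Relation.Unary.All as All using (All; []; _∷_)
open import Data.List.Relation.Unary.Any using (here)
open import Data.Nat using (ℕ; zero; suc; _+_; _*_; _∸_; _≤_; _<_; _<?_; z≤n; NonZero)
open import Data.Nat.Base using (s≤s⁻¹)
open import Data.Nat.Properties
  using (*-comm; *-suc; *-zeroʳ; +-suc; +-comm; ≤-total; <-irrefl; <-trans; <-≤-trans; <-cmp;
         n<1+n; 1+n≰n; <⇒≤; m≤n⇒m<n∨m≡n; m+[n∸m]≡n; m∸n≤m; ∸-monoˡ-<; m*n≢0⇒m≢0;
         ^-distribˡ-+-*)
open import Data.Nat.Coprimality using (Coprime; coprime-divisor)
open import Data.Nat.DivMod using (_%_; _/_; m≡m%n+[m/n]*n; m%n<n)
open import Data.Nat.Divisibility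
  using (_∣_; divides; _∣?_; ∣1⇒≡1; m%n≡0⇒n∣m; *-cancelˡ-∣; *-cancelʳ-∣)
open import Data.Nat.GCD using (gcd; gcd-GCD; gcd[m,n]∣m; gcd[m,n]∣n; module Bézout)
open import Data.Nat.ListAction using (product)
open import Data.Nat.ListAction.Properties using (∈⇒∣product)
open import Data.Nat.Primality using (Prime; prime⇒irreducible; prime⇒nonZero; ¬prime[1]; prime[2])
open import Data.Nat.Primality.Factorisation using (factorise)
open import Data.Nat.Tactic.RingSolver using (solve-∀)
open import Data.Product using (Σ; ∃; ∃₂; _×_; _,_; proj₁; proj₂; map₂)
open import Data.Product.Properties using (≡-dec)
open import Data.Sum using (_⊎_; inj₁; inj₂; [_,_]′; swap)
open import Function using (_∘_; id)
open import Function.Bundles using (_⇔_; mk⇔; _↔_; Inverse; Injection; mk↔ₛ′; Equivalence)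
open import Function.Properties.Inverse using (Inverse⇒Injection; ↔-sym)
open import Function.Construct.Composition using (_⇔-∘_)
open import Function.Construct.Identity using (↔-id)
open import Relation.Binary.Definitions using (Decidable; DecidableEquality; Transitive; tri<; tri≈; tri>)
open import Relation.Nullary using (¬_; Dec; yes; no; ¬?; contradiction)
open import Relation.Nullary.Decidable using (isYes; toWitness; fromWitness; decidable-stable; _×-dec_; _⊎-dec_)
open import Relation.Binary.PropositionalEquality

least : {P : ℕ → Set} → (∀ k → Dec (P k)) → ∀ {n} → P n →
        ∃ λ m → P m × (∀ {k} → k < m → ¬ P k)
least {P} P? {n} Pn
  with ¬∀⟶∃¬-smallest (suc n) (λ i → ¬ P (toℕ i)) (λ i → ¬? (P? (toℕ i)))
         (λ ∀¬P → ∀¬P (fromℕ n) (subst P (sym (toℕ-fromℕ n)) Pn))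
... | i , ¬¬Pi , smaller = toℕ i , decidable-stable (P? (toℕ i)) ¬¬Pi , λ k<i →
  subst (λ k → ¬ P k) (trans (toℕ-inject (fromℕ< k<i)) (toℕ-fromℕ< k<i)) (smaller (fromℕ< k<i))

-- The witness is 0 when no k ≤ n satisfies P.
greatest : {P : ℕ → Set} → (∀ k → Dec (P k)) → ∀ n →
           ∃ λ m → (P m ⊎ m ≡ 0) × (∀ {k} → k ≤ n → P k → k ≤ m)
greatest P? zero = 0 , inj₂ refl , λ { z≤n _ → z≤n }
greatest P? (suc n) with P? (suc n)
... | yes P[1+n] = suc n , inj₁ P[1+n] , λ k≤1+n _ → k≤1+n
... | no ¬P[1+n] with greatest P? n
...   | m , Pm , maximal = m , Pm , λ k≤1+n Pk →
  [ (λ k<1+n → maximal (s≤s⁻¹ k<1+n) Pk) , (λ { refl → contradiction Pk ¬P[1+n] }) ]′ (m≤n⇒m<n∨m≡n k≤1+n)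

-- Divisor chains

module PrimePowers where

  open import Data.Nat using (_^_)

  DivisorChain : ℕ → Set
  DivisorChain n = ∀ {a b} → a ∣ n → b ∣ n → a ∣ b ⊎ b ∣ a

  ^-monoʳ-∣ : ∀ p {i j} → i ≤ j → p ^ i ∣ p ^ j
  ^-monoʳ-∣ p {i} {j} i≤j = divides (p ^ (j ∸ i)) (begin
    p ^ j                 ≡⟨ cong (p ^_) (sym (m+[n∸m]≡n i≤j)) ⟩
    p ^ (i + (j ∸ i))     ≡⟨ ^-distribˡ-+-* p i (j ∸ i) ⟩
    p ^ i * p ^ (j ∸ i)   ≡⟨ *-comm (p ^ i) _ ⟩
    p ^ (j ∸ i) * p ^ i   ∎)
    where open ≡-Reasoning

  module _ {p : ℕ} (p-prime : Prime p) where

    ∤⇒coprime : ∀ {d} → ¬ p ∣ d → Coprime d p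
    ∤⇒coprime p∤d (c∣d , c∣p) with prime⇒irreducible p-prime c∣p
    ... | inj₁ c≡1 = c≡1
    ... | inj₂ refl = contradiction c∣d p∤d

    ∣p^m⇒≡p^i : ∀ m {d} → d ∣ p ^ m → ∃ λ i → d ≡ p ^ i
    ∣p^m⇒≡p^i zero d∣1 = 0 , ∣1⇒≡1 d∣1
    ∣p^m⇒≡p^i (suc m) {d} d∣p^[1+m] with p ∣? d
    ... | no p∤d = ∣p^m⇒≡p^i m (coprime-divisor (∤⇒coprime p∤d) d∣p^[1+m])
    ... | yes (divides q refl) with ∣p^m⇒≡p^i m q∣p^m
      where
      instance
        p≢0 : NonZero p
        p≢0 = prime⇒nonZero p-prime
      q∣p^m : q ∣ p ^ m
      q∣p^m = *-cancelʳ-∣ p (subst (q * p ∣_) (*-comm p (p ^ m)) d∣p^[1+m])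
    ...   | i , refl = suc i , *-comm (p ^ i) p

    primePower⇒divisorChain : ∀ m → DivisorChain (p ^ m)
    primePower⇒divisorChain m a∣p^m b∣p^m
      with ∣p^m⇒≡p^i m a∣p^m | ∣p^m⇒≡p^i m b∣p^m
    ... | i , refl | j , refl with ≤-total i j
    ...   | inj₁ i≤j = inj₁ (^-monoʳ-∣ p i≤j)
    ...   | inj₂ j≤i = inj₂ (^-monoʳ-∣ p j≤i)

  prime∣prime⇒≡ : ∀ {p q} → Prime p → Prime q → p ∣ q → p ≡ q
  prime∣prime⇒≡ p-prime q-prime p∣q with prime⇒irreducible q-prime p∣q
  ... | inj₁ refl = contradiction p-prime ¬prime[1]
  ... | inj₂ p≡q = p≡q

  product-replicate : ∀ {p} {ns : List ℕ} → All (_≡ p) ns → product ns ≡ p ^ length ns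
  product-replicate [] = refl
  product-replicate {p} (refl ∷ eqs) = cong (p *_) (product-replicate eqs)

  -- All prime factors of n must coincide, since any two of them divide one another.
  divisorChain⇒primePower : ∀ {n} .{{_ : NonZero n}} → DivisorChain n →
                            ∃₂ λ p m → Prime p × n ≡ p ^ m
  divisorChain⇒primePower {n} chain with factorise n
  ... | record { factors = [] ; isFactorisation = n≡1 } = 2 , 0 , prime[2] , n≡1
  ... | record { factors = q ∷ qs ; isFactorisation = n≡Π ; factorsPrime = q-prime ∷ qs-prime } =
    q , length (q ∷ qs) , q-prime , trans n≡Π (product-replicate (All.tabulate ≡q))
    where
    ∈⇒∣n : ∀ {r} → r ∈ (q ∷ qs) → r ∣ n
    ∈⇒∣n r∈ = subst (_ ∣_) (sym n≡Π) (∈⇒∣product r∈)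
    ≡q : ∀ {r} → r ∈ q ∷ qs → r ≡ q
    ≡q r∈ with chain (∈⇒∣n r∈) (∈⇒∣n (here refl))
    ... | inj₁ r∣q = prime∣prime⇒≡ (All.lookup (q-prime ∷ qs-prime) r∈) q-prime r∣q
    ... | inj₂ q∣r = sym (prime∣prime⇒≡ q-prime (All.lookup (q-prime ∷ qs-prime) r∈) q∣r)

open PrimePowers

-- Graphs with homomorphisms to and from a complete graph

K : ℕ → Graph
K n = record { V = Fin n ; E = λ i j → i ≢ j }

Irreflexive : Graph → Set
Irreflexive Γ = ∀ {x y} → E Γ x y → x ≢ y

record _⇄_ (Γ Δ : Graph) : Set where
  field
    forth : Hom Γ Δ
    back  : Hom Δ Γ
open _⇄_

⇄-trans : ∀ {Γ Δ Θ} → Γ ⇄ Δ → Δ ⇄ Θ → Γ ⇄ Θ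
⇄-trans record { forth = f , f-hom ; back = f′ , f′-hom }
        record { forth = g , g-hom ; back = g′ , g′-hom } =
  record { forth = g ∘ f , (λ e → g-hom (f-hom e)) ; back = f′ ∘ g′ , (λ e → f′-hom (g′-hom e)) }

inclusion : ∀ {Γ} (Λ : Subgraph Γ) → Hom (asGraph Λ) Γ
inclusion Λ = proj₁ , edge-sub Λ

⇄-induced-all : ∀ Γ → Γ ⇄ Induced Γ (λ _ → true)
⇄-induced-all Γ = record { forth = (λ x → x , _) , id ; back = proj₁ , id }

induced-≟ : ∀ Γ S → DecidableEquality (V Γ) → DecidableEquality (V (Induced Γ S))
induced-≟ Γ S _≟V_ = ≡-dec _≟V_ (λ x∈S x∈S′ → yes (T-irrelevant x∈S x∈S′))

induced-irreflexive : ∀ Γ S → Irreflexive Γ → Irreflexive (Induced Γ S)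
induced-irreflexive Γ S irrefl e = irrefl e ∘ cong proj₁

Fin-injective⇒surjective : ∀ {n} (f : Fin n → Fin n) → (∀ {i j} → f i ≡ f j → i ≡ j) →
                           ∀ j → ∃ λ i → f i ≡ j
Fin-injective⇒surjective {suc n} f f-injective j with any? (λ i → f i ≟ j)
... | yes hit = hit
... | no miss = contradiction (injective⇒≤ {f = avoid} avoid-injective) 1+n≰n
  where
  j≢f : ∀ i → j ≢ f i
  j≢f i j≡fi = miss (i , sym j≡fi)
  avoid : Fin (suc n) → Fin n
  avoid i = punchOut (j≢f i)
  avoid-injective : ∀ {i i′} → avoid i ≡ avoid i′ → i ≡ i′
  avoid-injective eq = f-injective (punchOut-injective (j≢f _) (j≢f _) eq)

-- The endomorphism  clique ∘ colouring  is an automorphism, so the colouring is injective on Δ.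
core⇄K⇒complete : ∀ {Δ n} → IsCore Δ → Δ ⇄ K n → IsComplete Δ
core⇄K⇒complete {Δ} core record { forth = col , col-hom ; back = cl , cl-hom } v w v≢w
  with core (cl ∘ col , λ e → cl-hom (col-hom e))
... | (f⁻¹ , _) , _ , f∘f⁻¹ = subst₂ (E Δ) (f∘f⁻¹ v) (f∘f⁻¹ w) (cl-hom col≢col)
  where
  col≢col : col (f⁻¹ v) ≢ col (f⁻¹ w)
  col≢col eq = v≢w (trans (sym (f∘f⁻¹ v)) (trans (cong cl eq) (f∘f⁻¹ w)))

module _ {Δ : Graph} {n : ℕ} (complete : IsComplete Δ) (V↔Fin : V Δ ↔ Fin n) where
  open Inverse V↔Fin using (to; from)

  private
    to-injective : ∀ {x y} → to x ≡ to y → x ≡ y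
    to-injective = Injection.injective (Inverse⇒Injection V↔Fin)

    from-injective : ∀ {i j} → from i ≡ from j → i ≡ j
    from-injective = Injection.injective (Inverse⇒Injection (↔-sym V↔Fin))

  complete⇒K-hom : Hom (K n) Δ
  complete⇒K-hom = from , λ i≢j → complete _ _ (i≢j ∘ from-injective)

  -- Adjacent vertices cannot be merged, so every endomorphism is injective, hence bijective.
  complete⇒core : Irreflexive Δ → IsCore Δ
  complete⇒core irrefl (f , f-hom) = (f⁻¹ , f⁻¹-hom) , f⁻¹∘f , f∘f⁻¹
    where
    f-injective : ∀ {x y} → f x ≡ f y → x ≡ y
    f-injective {x} {y} fx≡fy with to x ≟ to y
    ... | yes eq  = to-injective eq
    ... | no  neq = contradiction fx≡fy (irrefl (f-hom (complete x y (neq ∘ cong to))))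
    preimage : ∀ y → ∃ λ x → f x ≡ y
    preimage y
      with Fin-injective⇒surjective (to ∘ f ∘ from) (from-injective ∘ f-injective ∘ to-injective) (to y)
    ... | i , fi≡y = from i , to-injective fi≡y
    f⁻¹ : V Δ → V Δ
    f⁻¹ = proj₁ ∘ preimage
    f∘f⁻¹ : ∀ y → f (f⁻¹ y) ≡ y
    f∘f⁻¹ = proj₂ ∘ preimage
    f⁻¹∘f : ∀ x → f⁻¹ (f x) ≡ x
    f⁻¹∘f x = f-injective (f∘f⁻¹ (f x))
    f⁻¹-hom : IsHom Δ Δ f⁻¹
    f⁻¹-hom {x} {y} e =
      complete _ _ (λ eq → irrefl e (trans (sym (f∘f⁻¹ x)) (trans (cong f eq) (f∘f⁻¹ y))))

module CliqueSubgraph {Γ : Graph} (_≟V_ : DecidableEquality (V Γ)) (irrefl : Irreflexive Γ)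
                      {n : ℕ} (clique : Hom (K n) Γ) where

  cl : Fin n → V Γ
  cl = proj₁ clique

  cl-injective : ∀ {i j} → cl i ≡ cl j → i ≡ j
  cl-injective {i} {j} eq with i ≟ j
  ... | yes i≡j = i≡j
  ... | no  i≢j = contradiction eq (irrefl (proj₂ clique i≢j))

  inClique? : ∀ x → Dec (∃ λ i → cl i ≡ x)
  inClique? x = any? (λ i → cl i ≟V x)

  member : V Γ → Bool
  member x = isYes (inClique? x)

  distinct : V Γ → V Γ → Bool
  distinct x y = isYes (¬? (x ≟V y))

  distinct-sym : ∀ x y → distinct x y ≡ distinct y x
  distinct-sym x y with x ≟V y | y ≟V x
  ... | yes _   | yes _   = refl
  ... | no _    | no _    = refl
  ... | yes x≡y | no y≢x  = contradiction (sym x≡y) y≢x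
  ... | no x≢y  | yes y≡x = contradiction (sym y≡x) x≢y

  clique-edge : ∀ {x y} → T ((member x ∧ member y) ∧ distinct x y) → E Γ x y
  clique-edge {x} {y} t with Equivalence.to T-∧ t
  ... | x∧y , x≢y with Equivalence.to T-∧ x∧y
  ...   | x∈ , y∈ with toWitness {a? = inClique? x} x∈ | toWitness {a? = inClique? y} y∈
  ...     | i , refl | j , refl =
    proj₂ clique (λ i≡j → toWitness {a? = ¬? (cl i ≟V cl j)} x≢y (cong cl i≡j))

  Λ : Subgraph Γ
  Λ = record
    { vert      = member
    ; edge      = λ x y → (member x ∧ member y) ∧ distinct x y
    ; edge-sub  = clique-edge
    ; edge-vert = λ t → Equivalence.to T-∧ (proj₁ (Equivalence.to T-∧ t))
    ; edge-sym  = λ x y → cong₂ _∧_ (∧-comm (member x) (member y)) (distinct-sym x y) }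

  member-≡ : ∀ {x y} → x ≡ y → (x∈ : T (member x)) (y∈ : T (member y)) →
             _≡_ {A = V (asGraph Λ)} (x , x∈) (y , y∈)
  member-≡ refl x∈ y∈ = cong (_ ,_) (T-irrelevant x∈ y∈)

  Λ-complete : IsComplete (asGraph Λ)
  Λ-complete (x , x∈) (y , y∈) ne = Equivalence.from T-∧
    (Equivalence.from T-∧ (x∈ , y∈) , fromWitness (λ x≡y → ne (member-≡ x≡y x∈ y∈)))

  Λ-irreflexive : Irreflexive (asGraph Λ)
  Λ-irreflexive e = irrefl (clique-edge e) ∘ cong proj₁

  Λ↔Fin : V (asGraph Λ) ↔ Fin n
  Λ↔Fin = mk↔ₛ′
    (λ (x , x∈) → proj₁ (toWitness {a? = inClique? x} x∈))
    (λ i → cl i , fromWitness (i , refl))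
    (λ i → cl-injective (proj₂ (toWitness (fromWitness {a? = inClique? (cl i)} (i , refl)))))
    (λ (x , x∈) → member-≡ (proj₂ (toWitness {a? = inClique? x} x∈)) _ x∈)

⇄K⇒cores-complete : ∀ {Γ n} → DecidableEquality (V Γ) → Irreflexive Γ → Γ ⇄ K n →
  (Σ (Subgraph Γ) λ Λ → IsCoreOf Γ Λ × IsComplete (asGraph Λ))
  × ((Λ : Subgraph Γ) → IsCoreOf Γ Λ → IsComplete (asGraph Λ))
⇄K⇒cores-complete {Γ} _≟V_ irrefl Γ⇄K =
  (Λ , (Λ-core , Γ→Λ) , Λ-complete) , every-core-complete
  where
  open CliqueSubgraph _≟V_ irrefl (back Γ⇄K)
  Λ-core : IsCore (asGraph Λ)
  Λ-core = complete⇒core Λ-complete Λ↔Fin Λ-irreflexive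
  Γ→Λ : Hom Γ (asGraph Λ)
  Γ→Λ with complete⇒K-hom Λ-complete Λ↔Fin | forth Γ⇄K
  ... | ι , ι-hom | col , col-hom = ι ∘ col , λ e → ι-hom (col-hom e)
  every-core-complete : (Λ′ : Subgraph Γ) → IsCoreOf Γ Λ′ → IsComplete (asGraph Λ′)
  every-core-complete Λ′ (core , Γ→Λ′) =
    core⇄K⇒complete core (⇄-trans record { forth = inclusion Λ′ ; back = Γ→Λ′ } Γ⇄K)

core⇔complete : ∀ {Γ m n} → Irreflexive Γ → V Γ ↔ Fin m → Γ ⇄ K n → IsCore Γ ⇔ IsComplete Γ
core⇔complete irrefl V↔Fin Γ⇄K =
  mk⇔ (λ core → core⇄K⇒complete core Γ⇄K) (λ complete → complete⇒core complete V↔Fin irrefl)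

-- Comparability graphs of finite strict orders

Comparability : {A : Set} → (A → A → Set) → Graph
Comparability {A} _<_ = record { V = A ; E = λ x y → x < y ⊎ y < x }

-- Mirsky: colour each element by the length of the longest chain ending in it.
module Heights {N : ℕ} {_⊏_ : Fin N → Fin N → Set} (_⊏?_ : Decidable _⊏_)
               (⊏-trans : Transitive _⊏_) (⊏-irrefl : ∀ {x} → ¬ x ⊏ x) (S : Fin N → Bool) where

  data Chain : ℕ → Fin N → Set where
    single : ∀ {x} → T (S x) → Chain 1 x
    extend : ∀ {k x y} → Chain k y → y ⊏ x → T (S x) → Chain (suc k) x

  chain? : ∀ k x → Dec (Chain k x)
  chain? zero          x = no λ ()
  chain? (suc zero)    x with T? (S x)
  ... | yes x∈S = yes (single x∈S)
  ... | no  x∉S = no λ { (single x∈S) → x∉S x∈S }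
  chain? (suc (suc k)) x with T? (S x) | any? (λ y → (y ⊏? x) ×-dec chain? (suc k) y)
  ... | no  x∉S | _                  = no λ { (extend _ _ x∈S) → x∉S x∈S }
  ... | yes x∈S | yes (y , y⊏x , c)  = yes (extend c y⊏x x∈S)
  ... | yes x∈S | no  none           = no λ { (extend c y⊏x _) → none (_ , y⊏x , c) }

  elem : ∀ {k x} → Chain k x → Fin k → Fin N
  elem {x = x} (single _)     zero    = x
  elem {x = x} (extend _ _ _) zero    = x
  elem         (extend c _ _) (suc i) = elem c i

  elem-S : ∀ {k x} (c : Chain k x) i → T (S (elem c i))
  elem-S (single x∈S)     zero    = x∈S
  elem-S (extend _ _ x∈S) zero    = x∈S
  elem-S (extend c _ _)   (suc i) = elem-S c i

  elem-below : ∀ {k x} (c : Chain (suc k) x) (i : Fin k) → elem c (suc i) ⊏ x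
  elem-below (extend (single _)     y⊏x _) zero    = y⊏x
  elem-below (extend (extend _ _ _) y⊏x _) zero    = y⊏x
  elem-below (extend c@(extend _ _ _) y⊏x _) (suc i) = ⊏-trans (elem-below c i) y⊏x

  elem-comparable : ∀ {k x} (c : Chain k x) {i j} → i ≢ j → elem c i ⊏ elem c j ⊎ elem c j ⊏ elem c i
  elem-comparable c                 {zero}  {zero}  i≢j = contradiction refl i≢j
  elem-comparable c@(extend _ _ _)  {zero}  {suc j} _   = inj₂ (elem-below c j)
  elem-comparable c@(extend _ _ _)  {suc i} {zero}  _   = inj₁ (elem-below c i)
  elem-comparable (extend c _ _)    {suc i} {suc j} i≢j = elem-comparable c (λ i≡j → i≢j (cong suc i≡j))

  elem-injective : ∀ {k x} (c : Chain k x) {i j} → elem c i ≡ elem c j → i ≡ j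
  elem-injective c {i} {j} eq with i ≟ j
  ... | yes i≡j = i≡j
  ... | no  i≢j with elem-comparable c i≢j
  ...   | inj₁ i⊏j = contradiction (subst (_⊏ elem c j) eq i⊏j) ⊏-irrefl
  ...   | inj₂ j⊏i = contradiction (subst (elem c j ⊏_) eq j⊏i) ⊏-irrefl

  chain-length : ∀ {k x} → Chain k x → k ≤ N
  chain-length c = injective⇒≤ (elem-injective c)

  tallest : ∀ x → ∃ λ h → (Chain (suc h) x ⊎ h ≡ 0) × (∀ {k} → k ≤ N → Chain (suc k) x → k ≤ h)
  tallest x = greatest (λ k → chain? (suc k) x) N

  longest : ∃ λ n → ((∃ λ x → Chain n x) ⊎ n ≡ 0) ×
                    (∀ {k} → k ≤ N → (∃ λ x → Chain k x) → k ≤ n)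
  longest = greatest (λ k → any? (chain? k)) N

  height : Fin N → ℕ
  height x = proj₁ (tallest x)

  height-chain : ∀ {x} → T (S x) → Chain (suc (height x)) x
  height-chain {x} x∈S =
    [ id , (λ h≡0 → subst (λ h → Chain (suc h) x) (sym h≡0) (single x∈S)) ]′ (proj₁ (proj₂ (tallest x)))

  height-maximal : ∀ {k x} → Chain (suc k) x → k ≤ height x
  height-maximal {x = x} c = proj₂ (proj₂ (tallest x)) (<⇒≤ (chain-length c)) c

  height-increasing : ∀ {x y} → T (S x) → T (S y) → x ⊏ y → height x < height y
  height-increasing x∈S y∈S x⊏y = height-maximal (extend (height-chain x∈S) x⊏y y∈S)

  n : ℕ
  n = proj₁ longest

  height<n : ∀ {x} → T (S x) → height x < n
  height<n {x} x∈S = proj₂ (proj₂ longest) (chain-length c) (x , c)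
    where
    c : Chain (suc (height x)) x
    c = height-chain x∈S

  Γ : Graph
  Γ = Induced (Comparability _⊏_) S

  colour : V Γ → Fin n
  colour (x , x∈S) = fromℕ< (height<n x∈S)

  colour-proper : IsHom Γ (K n) colour
  colour-proper {x , x∈S} {y , y∈S} x⊏y⊎y⊏x colour≡ =
    [ (λ x⊏y → <-irrefl hx≡hy (height-increasing x∈S y∈S x⊏y))
    , (λ y⊏x → <-irrefl (sym hx≡hy) (height-increasing y∈S x∈S y⊏x)) ]′ x⊏y⊎y⊏x
    where
    hx≡hy : height x ≡ height y
    hx≡hy = trans (sym (toℕ-fromℕ< (height<n x∈S)))
                  (trans (cong toℕ colour≡) (toℕ-fromℕ< (height<n y∈S)))

  chain-clique : ∀ {m} → (∃ λ x → Chain m x) ⊎ m ≡ 0 → Hom (K m) Γ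
  chain-clique (inj₁ (x , c)) = (λ i → elem c i , elem-S c i) , elem-comparable c
  chain-clique (inj₂ refl)    = (λ ()) , λ { {()} }

  comparability⇄K : Γ ⇄ K n
  comparability⇄K = record
    { forth = colour , λ {x} {y} → colour-proper {x} {y}
    ; back  = chain-clique (proj₁ (proj₂ longest)) }

-- Mutually related elements (for powers: generators of the same cyclic subgroup) are ordered by index.
module TieBreak {N : ℕ} {_≼_ : Fin N → Fin N → Set}
                (_≼?_ : Decidable _≼_) (≼-trans : Transitive _≼_) where

  _≺_ : Fin N → Fin N → Set
  x ≺ y = x ≼ y × (¬ y ≼ x ⊎ toℕ x < toℕ y)

  _≺?_ : Decidable _≺_
  x ≺? y = (x ≼? y) ×-dec (¬? (y ≼? x) ⊎-dec (toℕ x <? toℕ y))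

  ≺-irrefl : ∀ {x} → ¬ x ≺ x
  ≺-irrefl (x≼x , inj₁ x⋠x) = x⋠x x≼x
  ≺-irrefl (_   , inj₂ x<x) = <-irrefl refl x<x

  ≺-trans : Transitive _≺_
  ≺-trans {x} {y} {z} (x≼y , y⋠x⊎x<y) (y≼z , z⋠y⊎y<z) =
    ≼-trans x≼y y≼z , strict y⋠x⊎x<y z⋠y⊎y<z
    where
    strict : ¬ y ≼ x ⊎ toℕ x < toℕ y → ¬ z ≼ y ⊎ toℕ y < toℕ z → ¬ z ≼ x ⊎ toℕ x < toℕ z
    strict _          _          with z ≼? x
    strict _          _          | no z⋠x  = inj₁ z⋠x
    strict (inj₁ y⋠x) _          | yes z≼x = contradiction (≼-trans y≼z z≼x) y⋠x
    strict (inj₂ _)   (inj₁ z⋠y) | yes z≼x = contradiction (≼-trans z≼x x≼y) z⋠y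
    strict (inj₂ x<y) (inj₂ y<z) | yes _   = inj₂ (<-trans x<y y<z)

  ≺⇒≼ : ∀ {x y} → x ≺ y → x ≼ y
  ≺⇒≼ = proj₁

  ≺⇒≢ : ∀ {x y} → x ≺ y → x ≢ y
  ≺⇒≢ x≺x refl = ≺-irrefl x≺x

  ≼⇒≺⊎≻ : ∀ {x y} → x ≢ y → x ≼ y → x ≺ y ⊎ y ≺ x
  ≼⇒≺⊎≻ {x} {y} x≢y x≼y with y ≼? x
  ... | no y⋠x = inj₁ (x≼y , inj₁ y⋠x)
  ... | yes y≼x with <-cmp (toℕ x) (toℕ y)
  ...   | tri< x<y _ _ = inj₁ (x≼y , inj₂ x<y)
  ...   | tri≈ _ x≡y _ = contradiction (toℕ-injective x≡y) x≢y
  ...   | tri> _ _ y<x = inj₂ (y≼x , inj₂ y<x)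

-- Powers in a finite group

module GroupPowers (G : FiniteGroup) where
  open FiniteGroup G
  open IsGroup isGroup using (assoc; identityˡ; identityʳ)

  group : Group _ _
  group = record { isGroup = isGroup }

  open GroupProperties group using (∙-cancelˡ)
  open ≡-Reasoning

  ^-+ : ∀ x m n → x ^ (m + n) ≡ (x ^ m) ∙ (x ^ n)
  ^-+ x zero    n = sym (identityˡ _)
  ^-+ x (suc m) n = trans (cong (x ∙_) (^-+ x m n)) (sym (assoc _ _ _))

  ^-* : ∀ x m n → x ^ (m * n) ≡ (x ^ m) ^ n
  ^-* x m zero    = cong (x ^_) (*-zeroʳ m)
  ^-* x m (suc n) = begin
    x ^ (m * suc n)          ≡⟨ cong (x ^_) (*-suc m n) ⟩
    x ^ (m + m * n)          ≡⟨ ^-+ x m (m * n) ⟩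
    (x ^ m) ∙ (x ^ (m * n))  ≡⟨ cong ((x ^ m) ∙_) (^-* x m n) ⟩
    (x ^ m) ∙ ((x ^ m) ^ n)  ∎

  ε^ : ∀ n → ε ^ n ≡ ε
  ε^ zero    = refl
  ε^ (suc n) = trans (identityˡ _) (ε^ n)

  ^-comm : ∀ x m n → (x ^ m) ^ n ≡ (x ^ n) ^ m
  ^-comm x m n = trans (sym (^-* x m n)) (trans (cong (x ^_) (*-comm m n)) (^-* x n m))

  ^-cancel : ∀ x {m n} → m < n → x ^ m ≡ x ^ n → x ^ suc (n ∸ suc m) ≡ ε
  ^-cancel x {m} {n} m<n x^m≡x^n = sym (∙-cancelˡ (x ^ m) ε _ (begin
    (x ^ m) ∙ ε                       ≡⟨ identityʳ _ ⟩
    x ^ m                             ≡⟨ x^m≡x^n ⟩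
    x ^ n                             ≡⟨ cong (x ^_) (sym (trans (+-suc m _) (m+[n∸m]≡n m<n))) ⟩
    x ^ (m + suc (n ∸ suc m))         ≡⟨ ^-+ x m _ ⟩
    (x ^ m) ∙ (x ^ suc (n ∸ suc m))   ∎))

  module _ {x d} (x^d≡ε : x ^ d ≡ ε) where

    ^-*-period : ∀ l → x ^ (l * d) ≡ ε
    ^-*-period l = trans (cong (x ^_) (*-comm l d)) (trans (^-* x d l) (trans (cong (_^ l) x^d≡ε) (ε^ l)))

    ^-+-period : ∀ k l → x ^ (k + l * d) ≡ x ^ k
    ^-+-period k l = trans (^-+ x k (l * d)) (trans (cong ((x ^ k) ∙_) (^-*-period l)) (identityʳ _))

    ^-mod : .{{_ : NonZero d}} → ∀ k → x ^ k ≡ x ^ (k % d)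
    ^-mod k = trans (cong (x ^_) (m≡m%n+[m/n]*n k d)) (^-+-period (k % d) (k / d))

  period : ∀ x → ∃ λ d → x ^ suc d ≡ ε
  period x with pigeonhole (n<1+n order) (λ (i : Fin (suc order)) → x ^ toℕ i)
  ... | i , j , i<j , x^i≡x^j = toℕ j ∸ suc (toℕ i) , ^-cancel x i<j x^i≡x^j

  Comparable : Carrier → Carrier → Set
  Comparable x y = IsPowerOf y x ⊎ IsPowerOf x y

  powerOf-refl : ∀ x → IsPowerOf x x
  powerOf-refl x = 1 , sym (identityʳ x)

  powerOf-trans : ∀ {x y z} → IsPowerOf z y → IsPowerOf y x → IsPowerOf z x
  powerOf-trans {x} (l , refl) (k , refl) = k * l , sym (^-* x k l)

  ∣⇒powerOf : ∀ x {m n} → m ∣ n → IsPowerOf (x ^ n) (x ^ m)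
  ∣⇒powerOf x {m} (divides q refl) = q , trans (cong (x ^_) (*-comm q m)) (^-* x m q)

  powerOf? : ∀ y x → Dec (IsPowerOf y x)
  powerOf? y x with period x
  ... | d , x^d≡ε with any? (λ (i : Fin (suc d)) → y ≟ x ^ toℕ i)
  ...   | yes (i , y≡x^i) = yes (toℕ i , y≡x^i)
  ...   | no ¬small = no λ { (k , y≡x^k) → ¬small (fromℕ< (m%n<n k (suc d)) ,
          trans y≡x^k (trans (^-mod {x} {suc d} x^d≡ε k) (cong (x ^_) (sym (toℕ-fromℕ< (m%n<n k (suc d))))))) }

  -- Bézout's identity, with the negative coefficient turned positive modulo the period 1 + d.
  gcd-powerOf : ∀ {x d} → x ^ suc d ≡ ε → ∀ k → IsPowerOf (x ^ gcd k (suc d)) (x ^ k)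
  gcd-powerOf {x} {d} x^n≡ε k with Bézout.identity (gcd-GCD k (suc d))
  ... | Bézout.+- a b eq = a , (begin
    x ^ g                 ≡⟨ sym (^-+-period {x} {suc d} x^n≡ε g b) ⟩
    x ^ (g + b * suc d)   ≡⟨ cong (x ^_) eq ⟩
    x ^ (a * k)           ≡⟨ cong (x ^_) (*-comm a k) ⟩
    x ^ (k * a)           ≡⟨ ^-* x k a ⟩
    (x ^ k) ^ a           ∎)
    where
    g : ℕ
    g = gcd k (suc d)
  ... | Bézout.-+ a b eq = a * d , (begin
    x ^ g                               ≡⟨ sym (^-+-period {x} {suc d} x^n≡ε g (a * k)) ⟩
    x ^ (g + a * k * suc d)             ≡⟨ cong (x ^_) (regroup g a k d) ⟩
    x ^ ((g + a * k) + k * (a * d))     ≡⟨ cong (λ e → x ^ (e + k * (a * d))) eq ⟩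
    x ^ (b * suc d + k * (a * d))       ≡⟨ cong (x ^_) (+-comm (b * suc d) _) ⟩
    x ^ (k * (a * d) + b * suc d)       ≡⟨ ^-+-period {x} {suc d} x^n≡ε (k * (a * d)) b ⟩
    x ^ (k * (a * d))                   ≡⟨ ^-* x k (a * d) ⟩
    (x ^ k) ^ (a * d)                   ∎)
    where
    g : ℕ
    g = gcd k (suc d)
    regroup : ∀ g a k d → g + a * k * suc d ≡ (g + a * k) + k * (a * d)
    regroup = solve-∀

  comparable⇒cyclic : (∀ x y → Comparable x y) → IsCyclic
  comparable⇒cyclic comparable = proj₁ bound , λ x → All.lookup (proj₂ bound) (∈-allFin x)
    where
    upperBound : (xs : List Carrier) → ∃ λ g → All (λ x → IsPowerOf x g) xs
    upperBound []       = ε , []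
    upperBound (x ∷ xs) with upperBound xs
    ... | g , below with comparable g x
    ...   | inj₁ x∈⟨g⟩ = g , x∈⟨g⟩ ∷ below
    ...   | inj₂ g∈⟨x⟩ = x , powerOf-refl x ∷ All.map (λ y∈⟨g⟩ → powerOf-trans y∈⟨g⟩ g∈⟨x⟩) below
    bound : ∃ λ g → All (λ x → IsPowerOf x g) (allFin order)
    bound = upperBound (allFin order)

module Cyclic (G : FiniteGroup) (g : FiniteGroup.Carrier G)
              (generates : ∀ x → FiniteGroup.IsPowerOf G x g) where
  open FiniteGroup G
  open GroupPowers G
  open ≡-Reasoning

  minimalPeriod : ∃ λ d₀ → g ^ suc d₀ ≡ ε × (∀ {k} → k < d₀ → g ^ suc k ≢ ε)
  minimalPeriod = least (λ k → g ^ suc k ≟ ε) {proj₁ (period g)} (proj₂ (period g))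

  d₀ : ℕ
  d₀ = proj₁ minimalPeriod

  g^[1+d₀]≡ε : g ^ suc d₀ ≡ ε
  g^[1+d₀]≡ε = proj₁ (proj₂ minimalPeriod)

  g^[1+k]≢ε : ∀ {k} → k < d₀ → g ^ suc k ≢ ε
  g^[1+k]≢ε = proj₂ (proj₂ minimalPeriod)

  power : Fin (suc d₀) → Carrier
  power i = g ^ toℕ i

  power-distinct : ∀ {i j} → toℕ i < toℕ j → power i ≢ power j
  power-distinct {i} {j} i<j gⁱ≡gʲ = g^[1+k]≢ε j∸[1+i]<d₀ (^-cancel g i<j gⁱ≡gʲ)
    where
    j∸[1+i]<d₀ : toℕ j ∸ suc (toℕ i) < d₀
    j∸[1+i]<d₀ = <-≤-trans (∸-monoˡ-< (toℕ<n j) i<j) (m∸n≤m d₀ (toℕ i))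

  power-injective : ∀ {i j} → power i ≡ power j → i ≡ j
  power-injective {i} {j} gⁱ≡gʲ with Fin.<-cmp i j
  ... | tri< i<j _ _ = contradiction gⁱ≡gʲ (power-distinct i<j)
  ... | tri≈ _ i≡j _ = i≡j
  ... | tri> _ _ j<i = contradiction (sym gⁱ≡gʲ) (power-distinct j<i)

  exponent : Carrier → Fin (suc d₀)
  exponent x = fromℕ< (m%n<n (proj₁ (generates x)) (suc d₀))

  power-exponent : ∀ x → power (exponent x) ≡ x
  power-exponent x = begin
    g ^ toℕ (exponent x)       ≡⟨ cong (g ^_) (toℕ-fromℕ< (m%n<n k (suc d₀))) ⟩
    g ^ (k % suc d₀)           ≡⟨ sym (^-mod {g} {suc d₀} g^[1+d₀]≡ε k) ⟩
    g ^ k                      ≡⟨ sym x≡gᵏ ⟩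
    x                          ∎
    where
    k : ℕ
    k = proj₁ (generates x)
    x≡gᵏ : x ≡ g ^ k
    x≡gᵏ = proj₂ (generates x)

  order≡1+d₀ : order ≡ suc d₀
  order≡1+d₀ = cantor-schröder-bernstein {f = exponent} {g = power}
    (λ {x} {y} eq → trans (sym (power-exponent x)) (trans (cong power eq) (power-exponent y)))
    power-injective

  g^k≡ε⇒order∣k : ∀ {k} → g ^ k ≡ ε → order ∣ k
  g^k≡ε⇒order∣k {k} gᵏ≡ε = subst (_∣ k) (sym order≡1+d₀) (m%n≡0⇒n∣m k (suc d₀) k%n≡0)
    where
    k%n≡0 : k % suc d₀ ≡ 0
    k%n≡0 with k % suc d₀ in k%n≡r
    ... | zero  = refl
    ... | suc r = contradiction gʳ⁺¹≡ε (g^[1+k]≢ε (s≤s⁻¹ (subst (_< suc d₀) k%n≡r (m%n<n k (suc d₀)))))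
      where
      gʳ⁺¹≡ε : g ^ suc r ≡ ε
      gʳ⁺¹≡ε = begin
        g ^ suc r          ≡⟨ cong (g ^_) (sym k%n≡r) ⟩
        g ^ (k % suc d₀)   ≡⟨ sym (^-mod {g} {suc d₀} g^[1+d₀]≡ε k) ⟩
        g ^ k              ≡⟨ gᵏ≡ε ⟩
        ε                  ∎

  g^order≡ε : g ^ order ≡ ε
  g^order≡ε = subst (λ n → g ^ n ≡ ε) (sym order≡1+d₀) g^[1+d₀]≡ε

  private instance
    order≢0 : NonZero order
    order≢0 = nonZeroIndex ε

  -- g ^ s has order a, and powers of it have orders dividing a.
  cofactor-powerOf⇒∣ : ∀ s t {a b} → order ≡ s * a → order ≡ t * b →
                       IsPowerOf (g ^ t) (g ^ s) → b ∣ a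
  cofactor-powerOf⇒∣ s t {a} {b} n≡sa n≡tb (k , gᵗ≡gˢᵏ) =
    *-cancelˡ-∣ t {{t≢0}} (subst (_∣ t * a) n≡tb (g^k≡ε⇒order∣k gᵗᵃ≡ε))
    where
    t≢0 : NonZero t
    t≢0 = m*n≢0⇒m≢0 t {{subst NonZero n≡tb order≢0}}
    gᵗᵃ≡ε : g ^ (t * a) ≡ ε
    gᵗᵃ≡ε = begin
      g ^ (t * a)         ≡⟨ ^-* g t a ⟩
      (g ^ t) ^ a         ≡⟨ cong (_^ a) gᵗ≡gˢᵏ ⟩
      ((g ^ s) ^ k) ^ a   ≡⟨ ^-comm (g ^ s) k a ⟩
      ((g ^ s) ^ a) ^ k   ≡⟨ cong (_^ k) (sym (^-* g s a)) ⟩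
      (g ^ (s * a)) ^ k   ≡⟨ cong (λ n → (g ^ n) ^ k) (sym n≡sa) ⟩
      (g ^ order) ^ k     ≡⟨ cong (_^ k) g^order≡ε ⟩
      ε ^ k               ≡⟨ ε^ k ⟩
      ε                   ∎

  gcd-∣⇒powerOf : ∀ i j → gcd i order ∣ gcd j order → IsPowerOf (g ^ j) (g ^ i)
  gcd-∣⇒powerOf i j gcdᵢ∣gcdⱼ = powerOf-trans
    (powerOf-trans (∣⇒powerOf g (gcd[m,n]∣m j order)) (∣⇒powerOf g gcdᵢ∣gcdⱼ))
    (subst (λ n → IsPowerOf (g ^ gcd i n) (g ^ i)) (sym order≡1+d₀) (gcd-powerOf g^[1+d₀]≡ε i))

  divisorChain⇔comparable : DivisorChain order ⇔ (∀ x y → Comparable x y)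
  divisorChain⇔comparable = mk⇔ divisorChain⇒comparable comparable⇒divisorChain
    where
    divisorChain⇒comparable : DivisorChain order → ∀ x y → Comparable x y
    divisorChain⇒comparable chain x y with generates x | generates y
    ... | i , refl | j , refl with chain (gcd[m,n]∣n i order) (gcd[m,n]∣n j order)
    ...   | inj₁ gcdᵢ∣gcdⱼ = inj₁ (gcd-∣⇒powerOf i j gcdᵢ∣gcdⱼ)
    ...   | inj₂ gcdⱼ∣gcdᵢ = inj₂ (gcd-∣⇒powerOf j i gcdⱼ∣gcdᵢ)

    comparable⇒divisorChain : (∀ x y → Comparable x y) → DivisorChain order
    comparable⇒divisorChain comparable (divides s n≡sa) (divides t n≡tb) with comparable (g ^ s) (g ^ t)
    ... | inj₁ gᵗ∈⟨gˢ⟩ = inj₂ (cofactor-powerOf⇒∣ s t n≡sa n≡tb gᵗ∈⟨gˢ⟩)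
    ... | inj₂ gˢ∈⟨gᵗ⟩ = inj₁ (cofactor-powerOf⇒∣ t s n≡tb n≡sa gˢ∈⟨gᵗ⟩)

open import Data.Nat using (_^_)

module PowerGraphCores (G : FiniteGroup) where
  open FiniteGroup G using (Carrier; IsPowerOf; IsCyclic; order; ε)
  open GroupPowers G
  open TieBreak {_≼_ = IsPowerOf} powerOf? (λ x≼y y≼z → powerOf-trans x≼y y≼z)

  powerGraph⇄comparability : ∀ S → Induced (PowerGraph G) S ⇄ Induced (Comparability _≺_) S
  powerGraph⇄comparability S = record
    { forth = id , λ {x} {y} → forth-hom {x} {y}
    ; back  = id , λ {x} {y} → back-hom {x} {y} }
    where
    forth-hom : IsHom (Induced (PowerGraph G) S) (Induced (Comparability _≺_) S) id
    forth-hom (x≢y , inj₁ y≼x) = swap (≼⇒≺⊎≻ (x≢y ∘ sym) y≼x)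
    forth-hom (x≢y , inj₂ x≼y) = ≼⇒≺⊎≻ x≢y x≼y
    back-hom : IsHom (Induced (Comparability _≺_) S) (Induced (PowerGraph G) S) id
    back-hom (inj₁ x≺y) = ≺⇒≢ x≺y , inj₂ (≺⇒≼ x≺y)
    back-hom (inj₂ y≺x) = (≺⇒≢ y≺x ∘ sym) , inj₁ (≺⇒≼ y≺x)

  induced⇄K : ∀ S → ∃ λ n → Induced (PowerGraph G) S ⇄ K n
  induced⇄K S = n , ⇄-trans (powerGraph⇄comparability S) comparability⇄K
    where open Heights _≺?_ ≺-trans ≺-irrefl S

  powerGraph⇄K : ∃ λ n → PowerGraph G ⇄ K n
  powerGraph⇄K = map₂ (⇄-trans (⇄-induced-all (PowerGraph G))) (induced⇄K (λ _ → true))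

  powerGraph-irreflexive : Irreflexive (PowerGraph G)
  powerGraph-irreflexive = proj₁

  complete⇔comparable : IsComplete (PowerGraph G) ⇔ (∀ x y → Comparable x y)
  complete⇔comparable = mk⇔ complete⇒comparable (λ comparable x y x≢y → x≢y , comparable x y)
    where
    complete⇒comparable : IsComplete (PowerGraph G) → ∀ x y → Comparable x y
    complete⇒comparable complete x y with x ≟ y
    ... | yes refl = inj₁ (powerOf-refl x)
    ... | no  x≢y  = proj₂ (complete x y x≢y)

  CyclicOfPrimePowerOrder : Set
  CyclicOfPrimePowerOrder = ∃ λ p → ∃ λ m → Prime p × order ≡ p ^ m × IsCyclic

  comparable⇔cyclic-primePower : (∀ x y → Comparable x y) ⇔ CyclicOfPrimePowerOrder
  comparable⇔cyclic-primePower = mk⇔ comparable⇒cyclic-primePower cyclic-primePower⇒comparable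
    where
    instance
      order≢0 : NonZero order
      order≢0 = nonZeroIndex ε
    comparable⇒cyclic-primePower : (∀ x y → Comparable x y) → CyclicOfPrimePowerOrder
    comparable⇒cyclic-primePower comparable with comparable⇒cyclic comparable
    ... | g , generates
      with divisorChain⇒primePower (Equivalence.from (Cyclic.divisorChain⇔comparable G g generates) comparable)
    ...   | p , m , p-prime , order≡pᵐ = p , m , p-prime , order≡pᵐ , g , generates
    cyclic-primePower⇒comparable : CyclicOfPrimePowerOrder → ∀ x y → Comparable x y
    cyclic-primePower⇒comparable (p , m , p-prime , order≡pᵐ , g , generates) =
      Equivalence.to (Cyclic.divisorChain⇔comparable G g generates)
        (subst DivisorChain (sym order≡pᵐ) (primePower⇒divisorChain p-prime m))

corollary2p8 : (G : FiniteGroup) →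
    ((S : FiniteGroup.Carrier G → Bool) →
      (Σ (Subgraph (Induced (PowerGraph G) S)) λ Λ →
          IsCoreOf (Induced (PowerGraph G) S) Λ × IsComplete (asGraph Λ))
      × ((Λ : Subgraph (Induced (PowerGraph G) S)) →
          IsCoreOf (Induced (PowerGraph G) S) Λ → IsComplete (asGraph Λ)))
    × (IsCore (PowerGraph G) ⇔
        (∃ λ (p : ℕ) → ∃ λ (m : ℕ) →
          Prime p × FiniteGroup.order G ≡ p ^ m × FiniteGroup.IsCyclic G))
corollary2p8 G =
    (λ S → ⇄K⇒cores-complete (induced-≟ (PowerGraph G) S _≟_)
                              (induced-irreflexive (PowerGraph G) S powerGraph-irreflexive)
                              (proj₂ (induced⇄K S)))
  , comparable⇔cyclic-primePower ⇔-∘ (complete⇔comparable ⇔-∘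
      core⇔complete powerGraph-irreflexive (↔-id _) (proj₂ powerGraph⇄K))
  where open PowerGraphCores G
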